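{- Let $\mathcal{P}=\langle P,\le\rangle$ be a finite bounded poset with bottom $\bot$, top $\top$, $|P|\ge2$, and height $h$. Define $R^+(a)=[h(\uparrow a)-1,\ h-h(\downarrow a)]$ for $a\in P$. Then: (i) $R^+$ is a strict interval rank function for the order $\ge_W$; (ii) $R^+(\top)=[0,0]$ and $R^+(\bot)=[h-1,h-1]$; (iii) for every strict interval rank function $R$ for $\ge_W$ on $\mathcal{P}$ whose values all lie in $\overline{h-1}$ (intervals with integer endpoints in $\{0,\dots,h-1\}$), we have $R(a)\subseteq R^+(a)$ for all $a\in P$.
   Context: The height $h(Q)$ of a (sub)poset $Q$ is the size (number of elements) of its largest chain; $h=h(P)$. $\uparrow a=\{b\in P: b\ge a\}$ and $\downarrow a=\{b\in P:b\le a\}$, regarded as subposets. $\overline{\mathbb{N}}$ is the set of intervals $[x_*,x^*]$ with nonnegative integers $x_*\le x^*$. The order $\ge_W$ on intervals: $\bar x\ge_W\bar y$ iff $x_*\ge y_*$ and $x^*\ge y^*$. For an interval order $\sqsubseteq$, $R:P\to\overline{\mathbb{N}}$, $R(a)=[r_*(a),r^*(a)]$, is an interval rank function for $\sqsubseteq$ if for all $a<b$ in $P$, $R(a)\sqsubseteq R(b)$ and $R(a)\ne R(b)$; it is strict if $r_*$ and $r^*$ are strictly monotonic (for $\ge_W$: $a<b\Rightarrow r_*(a)>r_*(b)$ and $r^*(a)>r^*(b)$). $\subseteq$ on intervals is containment: $[x_*,x^*]\subseteq[y_*,y^*]$ iff $y_*\le x_*$ and $x^*\le y^*$. -}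

module Defs where

open import Level using (0ℓ)
open import Data.Nat using (ℕ; _≤_; _<_; _>_; _∸_)
open import Data.Fin using (Fin)
open import Data.Product using (_×_; _,_; proj₁; proj₂; ∃-syntax)
open import Data.List using (List; length)
open import Data.List.Relation.Unary.All using (All)
open import Data.List.Relation.Unary.Linked using (Linked)
open import Relation.Binary using (Rel)
open import Relation.Binary.PropositionalEquality using (_≡_; _≢_)

-- Intervals [x_*, x^*] of naturals, represented as pairs (x_* , x^*);
-- membership in N-bar (x_* ≤ x^*) is imposed separately by `Valid`.
Interval : Set
Interval = ℕ × ℕ

lo hi : Interval → ℕ
lo = proj₁
hi = proj₂

Valid : Interval → Set
Valid x = lo x ≤ hi x

_≥W_ : Interval → Interval → Set
x ≥W y = lo y ≤ lo x × hi y ≤ hi x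

_⊆I_ : Interval → Interval → Set
x ⊆I y = lo y ≤ lo x × hi x ≤ hi y

module _ {n : ℕ} (_≼_ : Rel (Fin n) 0ℓ) where

  _≺_ : Rel (Fin n) 0ℓ
  a ≺ b = a ≼ b × a ≢ b

  IsChain : List (Fin n) → Set
  IsChain xs = Linked _≺_ xs

  IsHeight : (Fin n → Set) → ℕ → Set
  IsHeight Q k =
    (∃[ xs ] (IsChain xs × All Q xs × length xs ≡ k))
    × (∀ xs → IsChain xs → All Q xs → length xs ≤ k)

  Up Down : Fin n → Fin n → Set
  Up a b = a ≼ b
  Down a b = b ≼ a

  IsIntervalRankW : (Fin n → Interval) → Set
  IsIntervalRankW R =
    (∀ a → Valid (R a))
    × (∀ a b → a ≺ b → (R a ≥W R b) × R a ≢ R b)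

  IsStrictIntervalRankW : (Fin n → Interval) → Set
  IsStrictIntervalRankW R =
    IsIntervalRankW R
    × (∀ a b → a ≺ b → lo (R a) > lo (R b) × hi (R a) > hi (R b))

-- A longest chain of ↓a followed by a longest chain of ↑a with a removed is a chain of P, so
-- h(↓a) + h(↑a) − 1 ≤ h and R⁺(a) is an interval; for a < b, prepending a to a chain of ↑b and
-- appending b to a chain of ↓a make both endpoints of R⁺ strict. Conversely, a strictly antitone
-- endpoint of R drops by at least one at each step of a chain: a longest chain of ↑a forces
-- r_*(a) ≥ h(↑a) − 1, and a longest chain of ↓a, whose bottom has r^* ≤ h − 1, forces
-- r^*(a) ≤ h − h(↓a).
module Submission where

open import Defs
open import Level using (0ℓ)
open import Data.Nat using (ℕ; suc; _≤_; _<_; _>_; _∸_; _+_; z≤n; s≤s)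
open import Data.Nat.Properties
open import Data.Fin using (Fin) renaming (_≟_ to _≟ᶠ_)
open import Data.Product using (_×_; _,_; proj₁; proj₂; Σ-syntax)
open import Data.Unit using (⊤; tt)
open import Data.Empty using (⊥-elim)
open import Data.List using (List; []; _∷_; _++_; length)
open import Data.List.Properties using (length-++; length-++-comm)
open import Data.List.Relation.Unary.All as All using (All; []; _∷_)
open import Data.List.Relation.Unary.All.Properties using (++⁺)
open import Data.List.Relation.Unary.Linked as Linked using ([]; [-]; _∷_)
open import Data.List.Relation.Unary.Linked.Properties using (Linked⇒AllPairs)
import Data.List.Relation.Unary.AllPairs as AllPairs
open import Relation.Binary using (Rel; IsPartialOrder; _Preserves_⟶_)
open import Function using (_∘_)
open import Relation.Binary.PropositionalEquality using (_≡_; _≢_; refl; sym; trans; cong; cong₂; subst)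
open import Relation.Nullary using (yes; no)

module _ {n : ℕ} {k : ℕ} {_≼_ : Rel (Fin n) 0ℓ} {Q : Fin n → Set} (height : IsHeight _≼_ Q k) where

  height-realised : {P : ℕ → Set} →
    (∀ {xs} → IsChain _≼_ xs → All Q xs → P (length xs)) → P k
  height-realised {P} prop with proj₁ height
  ... | xs , chain , inQ , refl = prop chain inQ

  length≤height : ∀ {xs} → IsChain _≼_ xs → All Q xs → length xs ≤ k
  length≤height = proj₂ height _

  height-mono : ∀ {Q′ k′} → (∀ {x} → Q x → Q′ x) → IsHeight _≼_ Q′ k′ → k ≤ k′
  height-mono Q⊆Q′ height′ = height-realised λ chain inQ → proj₂ height′ _ chain (All.map Q⊆Q′ inQ)

  height≤1-of-singleton : ∀ {c} → (∀ {x} → Q x → x ≡ c) → k ≤ 1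
  height≤1-of-singleton {c} only-c = height-realised at-most-one
    where
    at-most-one : ∀ {xs} → IsChain _≼_ xs → All Q xs → length xs ≤ 1
    at-most-one []              _             = z≤n
    at-most-one [-]             _             = s≤s z≤n
    at-most-one ((_ , x≢y) ∷ _) (qx ∷ qy ∷ _) = ⊥-elim (x≢y (trans (only-c qx) (sym (only-c qy))))

  1≤height : ∀ {a} → Q a → 1 ≤ k
  1≤height qa = length≤height [-] (qa ∷ [])

module Poset {n : ℕ} {_≼_ : Rel (Fin n) 0ℓ} (po : IsPartialOrder _≡_ _≼_) where
  open IsPartialOrder po using (reflexive; antisym) renaming (trans to ≼-trans)

  _⊏_ : Rel (Fin n) 0ℓ
  _⊏_ = _≺_ _≼_

  Chain : List (Fin n) → Set
  Chain = IsChain _≼_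

  ≼-refl : ∀ {a} → a ≼ a
  ≼-refl = reflexive refl

  ≼-⊏-trans : ∀ {a b c} → a ≼ b → b ⊏ c → a ⊏ c
  ≼-⊏-trans a≼b (b≼c , b≢c) = ≼-trans a≼b b≼c , λ { refl → b≢c (antisym b≼c a≼b) }

  ⊏-≼-trans : ∀ {a b c} → a ⊏ b → b ≼ c → a ⊏ c
  ⊏-≼-trans (a≼b , a≢b) b≼c = ≼-trans a≼b b≼c , λ { refl → a≢b (antisym a≼b b≼c) }

  ⊏-trans : ∀ {a b c} → a ⊏ b → b ⊏ c → a ⊏ c
  ⊏-trans a⊏b (b≼c , _) = ⊏-≼-trans a⊏b b≼c

  chain-head-⊏ : ∀ {x xs} → Chain (x ∷ xs) → All (x ⊏_) xs
  chain-head-⊏ chain = AllPairs.head (Linked⇒AllPairs ⊏-trans chain)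

  chain-++ : ∀ {a xs ys} → Chain xs → Chain ys → All (_≼ a) xs → All (a ⊏_) ys → Chain (xs ++ ys)
  chain-++ []          chain-ys _          _         = chain-ys
  chain-++ [-]         []       _          _         = [-]
  chain-++ [-]         chain-ys (x≼a ∷ _)  (a⊏y ∷ _) = ≼-⊏-trans x≼a a⊏y ∷ chain-ys
  chain-++ (x⊏x′ ∷ cs) chain-ys (_ ∷ xs≼a) ys⊐a      = x⊏x′ ∷ chain-++ cs chain-ys xs≼a ys⊐a

  chain-∷ : ∀ {a b ys} → a ⊏ b → Chain ys → All (b ≼_) ys → Chain (a ∷ ys)
  chain-∷ {ys = []}    a⊏b _     _         = [-]
  chain-∷ {ys = _ ∷ _} a⊏b chain (b≼y ∷ _) = ⊏-≼-trans a⊏b b≼y ∷ chain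

  drop-bottom : ∀ {a ys} → Chain ys → All (a ≼_) ys →
    Σ[ ys′ ∈ List (Fin n) ] Chain ys′ × All (a ⊏_) ys′ × length ys ∸ 1 ≤ length ys′
  drop-bottom {ys = []} chain _ = [] , [] , [] , z≤n
  drop-bottom {a} {y ∷ t} chain (a≼y ∷ _) with y ≟ᶠ a
  ... | yes refl = t , Linked.tail chain , chain-head-⊏ chain , ≤-refl
  ... | no y≢a   = y ∷ t , chain , a⊏y ∷ All.map (⊏-trans a⊏y) (chain-head-⊏ chain) , m∸n≤m _ 1
    where
    a⊏y : a ⊏ y
    a⊏y = a≼y , λ a≡y → y≢a (sym a≡y)

  module StrictlyAntitone {f : Fin n → ℕ} (f-anti : f Preserves _⊏_ ⟶ _>_) where

    antitone : ∀ {a b} → a ≼ b → f b ≤ f a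
    antitone {a} {b} a≼b with a ≟ᶠ b
    ... | yes refl = ≤-refl
    ... | no a≢b   = <⇒≤ (f-anti (a≼b , a≢b))

    tail-length≤ : ∀ {x xs} → Chain (x ∷ xs) → length xs ≤ f x
    tail-length≤ [-]           = z≤n
    tail-length≤ (x⊏y ∷ chain) = ≤-trans (s≤s (tail-length≤ chain)) (f-anti x⊏y)

    +tail-length≤ : ∀ {a x xs} → Chain (x ∷ xs) → All (_≼ a) (x ∷ xs) → f a + length xs ≤ f x
    +tail-length≤ [-] (x≼a ∷ []) = ≤-trans (≤-reflexive (+-identityʳ _)) (antitone x≼a)
    +tail-length≤ {a} {x} {y ∷ xs} (x⊏y ∷ chain) (_ ∷ below) = begin
      f a + suc (length xs)  ≡⟨ +-suc (f a) _ ⟩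
      suc (f a + length xs)  ≤⟨ s≤s (+tail-length≤ chain below) ⟩
      suc (f y)              ≤⟨ f-anti x⊏y ⟩
      f x                    ∎
      where open ≤-Reasoning

    above-length∸1≤ : ∀ {a ys} → Chain ys → All (a ≼_) ys → length ys ∸ 1 ≤ f a
    above-length∸1≤ {ys = []}    _     _         = z≤n
    above-length∸1≤ {ys = _ ∷ _} chain (a≼y ∷ _) = ≤-trans (tail-length≤ chain) (antitone a≼y)

    below-length∸1+≤ : ∀ {a m xs} → (∀ x → f x ≤ m) → Chain xs → All (_≼ a) xs → f a + (length xs ∸ 1) ≤ m
    below-length∸1+≤ {a} {xs = []}    bound _     _     = ≤-trans (≤-reflexive (+-identityʳ (f a))) (bound a)
    below-length∸1+≤     {xs = _ ∷ _} bound chain below = ≤-trans (+tail-length≤ chain below) (bound _)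

  module Heights (h : ℕ) (height : IsHeight _≼_ (λ _ → ⊤) h) (hUp hDown : Fin n → ℕ)
    (height-up   : ∀ a → IsHeight _≼_ (Up _≼_ a) (hUp a))
    (height-down : ∀ a → IsHeight _≼_ (Down _≼_ a) (hDown a)) where

    R⁺ : Fin n → Interval
    R⁺ a = hUp a ∸ 1 , h ∸ hDown a

    hUp-strictlyAntitone : hUp Preserves _⊏_ ⟶ _>_
    hUp-strictlyAntitone {a} {b} a⊏b = height-realised (height-up b) {P = _< hUp a} λ chain above-b →
      length≤height (height-up a) (chain-∷ a⊏b chain above-b)
        (≼-refl ∷ All.map (≼-trans (proj₁ a⊏b)) above-b)

    hDown-strictlyMonotone : hDown Preserves _⊏_ ⟶ _<_
    hDown-strictlyMonotone {a} {b} a⊏b = height-realised (height-down a) {P = _< hDown b}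
      λ {xs} chain below-a → subst (_≤ hDown b) (length-++-comm xs (b ∷ []))
        (length≤height (height-down b) (chain-++ chain [-] below-a (a⊏b ∷ []))
          (++⁺ (All.map (λ x≼a → ≼-trans x≼a (proj₁ a⊏b)) below-a) (≼-refl ∷ [])))

    hDown≤h : ∀ a → hDown a ≤ h
    hDown≤h a = height-mono (height-down a) (λ _ → tt) height

    hUp∸1+hDown≤h : ∀ a → hUp a ∸ 1 + hDown a ≤ h
    hUp∸1+hDown≤h a =
      height-realised (height-up a) {P = λ k → k ∸ 1 + hDown a ≤ h} λ {ys} chain-ys above-a →
      height-realised (height-down a) {P = λ k → length ys ∸ 1 + k ≤ h} λ {xs} chain-xs below-a →
      glue chain-xs below-a chain-ys above-a
      where
      glue : ∀ {xs ys} → Chain xs → All (_≼ a) xs → Chain ys → All (a ≼_) ys → length ys ∸ 1 + length xs ≤ h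
      glue {xs} {ys} chain-xs below-a chain-ys above-a with drop-bottom chain-ys above-a
      ... | ys′ , chain-ys′ , strictly-above , shorter = begin
        length ys ∸ 1 + length xs  ≤⟨ +-monoˡ-≤ (length xs) shorter ⟩
        length ys′ + length xs     ≡⟨ +-comm (length ys′) (length xs) ⟩
        length xs + length ys′     ≡⟨ length-++ xs ⟨
        length (xs ++ ys′)         ≤⟨ length≤height height (chain-++ chain-xs chain-ys′ below-a strictly-above)
                                        (All.universal (λ _ → tt) _) ⟩
        h                          ∎
        where open ≤-Reasoning

    R⁺-strictIntervalRank : IsStrictIntervalRankW _≼_ R⁺
    R⁺-strictIntervalRank = (R⁺-valid , λ _ _ a⊏b → weak (strict a⊏b)) , λ _ _ → strict
      where
      R⁺-valid : ∀ a → Valid (R⁺ a)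
      R⁺-valid a = m+n≤o⇒m≤o∸n (hUp a ∸ 1) (hUp∸1+hDown≤h a)

      strict : ∀ {a b} → a ⊏ b → lo (R⁺ a) > lo (R⁺ b) × hi (R⁺ a) > hi (R⁺ b)
      strict {a} {b} a⊏b =
        ∸-monoˡ-< (hUp-strictlyAntitone a⊏b) (1≤height (height-up b) ≼-refl) ,
        ∸-monoʳ-< (hDown-strictlyMonotone a⊏b) (hDown≤h b)

      weak : ∀ {a b} → lo (R⁺ a) > lo (R⁺ b) × hi (R⁺ a) > hi (R⁺ b) → (R⁺ a ≥W R⁺ b) × R⁺ a ≢ R⁺ b
      weak (lo> , hi>) = (<⇒≤ lo> , <⇒≤ hi>) , λ R⁺a≡R⁺b → <⇒≢ lo> (sym (cong proj₁ R⁺a≡R⁺b))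

    R⁺-maximal : (R : Fin n → Interval) → IsStrictIntervalRankW _≼_ R → (∀ a → hi (R a) ≤ h ∸ 1) →
      ∀ a → R a ⊆I R⁺ a
    R⁺-maximal R (_ , strict) bound a = lo-bound , hi-bound
      where
      module Lo = StrictlyAntitone {lo ∘ R} (λ a⊏b → proj₁ (strict _ _ a⊏b))
      module Hi = StrictlyAntitone {hi ∘ R} (λ a⊏b → proj₂ (strict _ _ a⊏b))

      lo-bound : hUp a ∸ 1 ≤ lo (R a)
      lo-bound = height-realised (height-up a) {P = λ k → k ∸ 1 ≤ lo (R a)} Lo.above-length∸1≤

      hi+hDown∸1≤h∸1 : hi (R a) + (hDown a ∸ 1) ≤ h ∸ 1
      hi+hDown∸1≤h∸1 = height-realised (height-down a) {P = λ k → hi (R a) + (k ∸ 1) ≤ h ∸ 1}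
        (Hi.below-length∸1+≤ bound)

      hi-bound : hi (R a) ≤ h ∸ hDown a
      hi-bound with hDown a | 1≤height (height-down a) ≼-refl | hi+hDown∸1≤h∸1
      ... | suc k | _ | hi+k≤h∸1 = subst (hi (R a) ≤_) (∸-+-assoc h 1 k) (m+n≤o⇒m≤o∸n (hi (R a)) hi+k≤h∸1)

    module Bounded (bot top : Fin n) (bot-least : ∀ a → bot ≼ a) (top-greatest : ∀ a → a ≼ top) where

      R⁺-top : R⁺ top ≡ (0 , 0)
      R⁺-top = cong₂ _,_ (m≤n⇒m∸n≡0 (height≤1-of-singleton (height-up top) λ {x} → antisym (top-greatest x)))
                         (m≤n⇒m∸n≡0 (height-mono height (λ {x} _ → top-greatest x) (height-down top)))

      R⁺-bot : R⁺ bot ≡ (h ∸ 1 , h ∸ 1)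
      R⁺-bot = cong₂ _,_ (cong (_∸ 1) hUp-bot) (cong (h ∸_) hDown-bot)
        where
        hUp-bot : hUp bot ≡ h
        hUp-bot = ≤-antisym (height-mono (height-up bot) (λ _ → tt) height)
                            (height-mono height (λ {x} _ → bot-least x) (height-up bot))
        hDown-bot : hDown bot ≡ 1
        hDown-bot = ≤-antisym (height≤1-of-singleton (height-down bot) λ {x} x≼bot → antisym x≼bot (bot-least x))
                              (1≤height (height-down bot) ≼-refl)

proposition3 : (n : ℕ) (_≼_ : Rel (Fin n) 0ℓ) → IsPartialOrder _≡_ _≼_ →
    (bot top : Fin n) → (∀ a → bot ≼ a) → (∀ a → a ≼ top) → 2 ≤ n →
    (h : ℕ) → IsHeight _≼_ (λ _ → ⊤) h →
    (hUp hDown : Fin n → ℕ) →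
    (∀ a → IsHeight _≼_ (Up _≼_ a) (hUp a)) →
    (∀ a → IsHeight _≼_ (Down _≼_ a) (hDown a)) →
    IsStrictIntervalRankW _≼_ (λ a → (hUp a ∸ 1 , h ∸ hDown a))
    × (_≡_ {A = Interval} (hUp top ∸ 1 , h ∸ hDown top) (0 , 0)
       × _≡_ {A = Interval} (hUp bot ∸ 1 , h ∸ hDown bot) (h ∸ 1 , h ∸ 1))
    × ((R : Fin n → Interval) → IsStrictIntervalRankW _≼_ R →
       (∀ a → hi (R a) ≤ h ∸ 1) →
       ∀ a → R a ⊆I (hUp a ∸ 1 , h ∸ hDown a))
proposition3 n _≼_ po bot top bot-least top-greatest _ h height hUp hDown height-up height-down =
  R⁺-strictIntervalRank , (R⁺-top , R⁺-bot) , R⁺-maximal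
  where
  open Poset po
  open Heights h height hUp hDown height-up height-down
  open Bounded bot top bot-least top-greatest
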